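{- Let $\langle\mathbf{A}_{\mathrm d},\mathbf{A},\iota\rangle$ be a distributively generated (generalized) additive quantale with multiplication, let $\mathbf{Q}$ be an $\mathbf{A}$-module, and let $\gamma$ be a nucleus on $\mathbf{Q}$ such that $a\ast\gamma(x)\leq\gamma(a\ast x)$ for all $x\in Q$ and all $a\in\iota[\mathbf{A}_{\mathrm d}]$. Then $\gamma$ is a structural nucleus, i.e. $a\ast\gamma(x)\leq\gamma(a\ast x)$ for all $a\in A$ and $x\in Q$.
   Context: Fix one of two parallel settings: plain ("joins" = joins of arbitrary families) or generalized ("joins" = joins of non-empty families). A (generalized) quantale is $\langle Q,\bigvee,+,\mathsf{0}\rangle$ with $Q$ a poset having all such joins, $\langle Q,+,\mathsf{0}\rangle$ a monoid with $+$ order-preserving and distributing over such joins on both sides. A (generalized) additive quantale with multiplication is a triple $\langle\mathbf{A}_{\mathrm d},\mathbf{A},\iota\rangle$: $\mathbf{A}_{\mathrm d}$ a monoid, $\mathbf{A}$ a (generalized) quantale with an additional monoid structure $\langle A,\cdot,\mathsf 1\rangle$, $\iota\colon\mathbf{A}_{\mathrm d}\to\mathbf{A}$ a monoid homomorphism, such that $(\bigvee_i a_i)\cdot b=\bigvee_i(a_i\cdot b)$, $(a+b)\cdot c=a\cdot c+b\cdot c$, $\mathsf0\cdot a=\mathsf0$, and for $d\in\mathbf{A}_{\mathrm d}$ left multiplication by $\iota(d)$ preserves joins, $+$ and $\mathsf0$. It is distributively generated if $\mathbf{A}$ is generated as a (generalized) quantale by $\iota[\mathbf{A}_{\mathrm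 d}]$. An $\mathbf{A}$-module is a (generalized) quantale $\mathbf{Q}$ with a map $\ast\colon A\times Q\to Q$, order-preserving in both coordinates, with $(a\cdot b)\ast x=a\ast(b\ast x)$, $\mathsf1\ast x=x$, $(a+b)\ast x=a\ast x+b\ast x$, $\mathsf0\ast x=\mathsf0$, $(\bigvee_i a_i)\ast x=\bigvee_i(a_i\ast x)$, and for $d\in\mathbf{A}_{\mathrm d}$ the map $x\mapsto\iota(d)\ast x$ preserves $+$, $\mathsf0$ and joins. A nucleus on $\mathbf{Q}$ is a map $\gamma\colon Q\to Q$ which is order-preserving, expansive, idempotent, and satisfies $\gamma(x)+\gamma(y)\leq\gamma(x+y)$. -}

module Defs where

open import Level using (Level; suc; Lift)
open import Data.Unit.Polymorphic using (⊤)
open import Data.Product using (Σ; _,_)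
open import Relation.Binary.PropositionalEquality using (_≡_)

-- The two parallel settings: plain (joins of arbitrary families) and
-- generalized (joins of non-empty families).
data Setting : Set where
  plain generalized : Setting

Admissible : ∀ {ℓ} → Setting → Set ℓ → Set ℓ
Admissible plain       I = ⊤
Admissible generalized I = I

record Quantale (s : Setting) (ℓ : Level) : Set (suc ℓ) where
  infixl 6 _+_
  infix 4 _≤_
  field
    Carrier   : Set ℓ
    _≤_       : Carrier → Carrier → Set ℓ
    ≤-refl    : ∀ {x} → x ≤ x
    ≤-trans   : ∀ {x y z} → x ≤ y → y ≤ z → x ≤ z
    ≤-antisym : ∀ {x y} → x ≤ y → y ≤ x → x ≡ y
    ⋁         : {I : Set ℓ} → Admissible s I → (I → Carrier) → Carrier
    ⋁-upper   : ∀ {I : Set ℓ} (p : Admissible s I) (f : I → Carrier) (i : I) → f i ≤ ⋁ p f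
    ⋁-least   : ∀ {I : Set ℓ} (p : Admissible s I) (f : I → Carrier) (x : Carrier) →
                (∀ i → f i ≤ x) → ⋁ p f ≤ x
    _+_       : Carrier → Carrier → Carrier
    0#        : Carrier
    +-assoc   : ∀ x y z → (x + y) + z ≡ x + (y + z)
    +-identityˡ : ∀ x → 0# + x ≡ x
    +-identityʳ : ∀ x → x + 0# ≡ x
    +-mono    : ∀ {x x′ y y′} → x ≤ x′ → y ≤ y′ → x + y ≤ x′ + y′
    +-distribˡ-⋁ : ∀ {I : Set ℓ} (p : Admissible s I) (f : I → Carrier) (x : Carrier) →
                   x + ⋁ p f ≡ ⋁ p (λ i → x + f i)
    +-distribʳ-⋁ : ∀ {I : Set ℓ} (p : Admissible s I) (f : I → Carrier) (x : Carrier) →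
                   ⋁ p f + x ≡ ⋁ p (λ i → f i + x)

record AddQuantaleMult (s : Setting) (ℓ : Level) : Set (suc ℓ) where
  infixl 7 _·_
  field
    quantale : Quantale s ℓ
  open Quantale quantale public
  field
    D         : Set ℓ
    _∙_       : D → D → D
    ε         : D
    ∙-assoc   : ∀ x y z → (x ∙ y) ∙ z ≡ x ∙ (y ∙ z)
    ∙-identityˡ : ∀ x → ε ∙ x ≡ x
    ∙-identityʳ : ∀ x → x ∙ ε ≡ x
    _·_       : Carrier → Carrier → Carrier
    1#        : Carrier
    ·-assoc   : ∀ x y z → (x · y) · z ≡ x · (y · z)
    ·-identityˡ : ∀ x → 1# · x ≡ x
    ·-identityʳ : ∀ x → x · 1# ≡ x
    ι         : D → Carrier
    ι-∙       : ∀ d e → ι (d ∙ e) ≡ ι d · ι e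
    ι-ε       : ι ε ≡ 1#
    ⋁-·       : ∀ {I : Set ℓ} (p : Admissible s I) (f : I → Carrier) (b : Carrier) →
                ⋁ p f · b ≡ ⋁ p (λ i → f i · b)
    +-·       : ∀ a b c → (a + b) · c ≡ a · c + b · c
    0-·       : ∀ a → 0# · a ≡ 0#
    ι-·-⋁     : ∀ (d : D) {I : Set ℓ} (p : Admissible s I) (f : I → Carrier) →
                ι d · ⋁ p f ≡ ⋁ p (λ i → ι d · f i)
    ι-·-+     : ∀ (d : D) a b → ι d · (a + b) ≡ ι d · a + ι d · b
    ι-·-0     : ∀ (d : D) → ι d · 0# ≡ 0#

data Generated {s : Setting} {ℓ : Level} (Q : Quantale s ℓ)
               (S : Quantale.Carrier Q → Set ℓ) : Quantale.Carrier Q → Set (suc ℓ) where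
  gen  : ∀ {x} → S x → Generated Q S x
  join : ∀ {I : Set ℓ} (p : Admissible s I) (f : I → Quantale.Carrier Q) →
         (∀ i → Generated Q S (f i)) → Generated Q S (Quantale.⋁ Q p f)
  plus : ∀ {x y} → Generated Q S x → Generated Q S y → Generated Q S (Quantale._+_ Q x y)
  zero : Generated Q S (Quantale.0# Q)

DistributivelyGenerated : ∀ {s ℓ} → AddQuantaleMult s ℓ → Set (suc ℓ)
DistributivelyGenerated A =
  ∀ a → Generated quantale (λ x → Σ D (λ d → ι d ≡ x)) a
  where open AddQuantaleMult A

record Module {s : Setting} {ℓ : Level} (A : AddQuantaleMult s ℓ) : Set (suc ℓ) where
  private module A = AddQuantaleMult A
  field
    Q : Quantale s ℓ
  open Quantale Q public
  infixr 7 _∗_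
  field
    _∗_     : A.Carrier → Carrier → Carrier
    ∗-mono  : ∀ {a b x y} → a A.≤ b → x ≤ y → a ∗ x ≤ b ∗ y
    ·-∗     : ∀ a b x → (a A.· b) ∗ x ≡ a ∗ (b ∗ x)
    1-∗     : ∀ x → A.1# ∗ x ≡ x
    +-∗     : ∀ a b x → (a A.+ b) ∗ x ≡ a ∗ x + b ∗ x
    0-∗     : ∀ x → A.0# ∗ x ≡ 0#
    ⋁-∗     : ∀ {I : Set ℓ} (p : Admissible s I) (f : I → A.Carrier) (x : Carrier) →
              A.⋁ p f ∗ x ≡ ⋁ p (λ i → f i ∗ x)
    ι-∗-+   : ∀ (d : A.D) x y → A.ι d ∗ (x + y) ≡ A.ι d ∗ x + A.ι d ∗ y
    ι-∗-0   : ∀ (d : A.D) → A.ι d ∗ 0# ≡ 0#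
    ι-∗-⋁   : ∀ (d : A.D) {I : Set ℓ} (p : Admissible s I) (f : I → Carrier) →
              A.ι d ∗ ⋁ p f ≡ ⋁ p (λ i → A.ι d ∗ f i)

record IsNucleus {s : Setting} {ℓ : Level} (Q : Quantale s ℓ)
                 (γ : Quantale.Carrier Q → Quantale.Carrier Q) : Set ℓ where
  open Quantale Q
  field
    mono       : ∀ {x y} → x ≤ y → γ x ≤ γ y
    expansive  : ∀ x → x ≤ γ x
    idempotent : ∀ x → γ (γ x) ≡ γ x
    +-lax      : ∀ x y → γ x + γ y ≤ γ (x + y)

-- The elements a for which a ∗ γ x ≤ γ (a ∗ x) holds form a sub-(generalized)
-- quantale of A: joins pass through ∗ on the left, + and 0 are handled by the
-- laxity γ x + γ y ≤ γ (x + y) and expansiveness of γ, and monotonicity of γ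
-- moves each bound under the join.  Since this subquantale contains ι[A_d],
-- it contains everything that ι[A_d] generates, i.e. all of A.
module Submission where

open import Defs
open import Data.Product using (_,_)
open import Relation.Binary.Bundles using (Poset)
open import Relation.Binary.PropositionalEquality using (_≡_; refl; cong; isEquivalence)

module _ {s ℓ} (Q : Quantale s ℓ) where
  open Quantale Q

  ≤-reflexive : ∀ {x y} → x ≡ y → x ≤ y
  ≤-reflexive refl = ≤-refl

  ≤-poset : Poset ℓ ℓ ℓ
  ≤-poset = record
    { _≈_ = _≡_
    ; _≤_ = _≤_
    ; isPartialOrder = record
      { isPreorder = record
        { isEquivalence = isEquivalence
        ; reflexive = ≤-reflexive
        ; trans = ≤-trans
        }
      ; antisym = ≤-antisym
      }
    }

  Generated-⊆ : ∀ {S : Carrier → Set ℓ} {p} (P : Carrier → Set p) →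
    (∀ {x} → S x → P x) →
    (∀ {I : Set ℓ} (adm : Admissible s I) (f : I → Carrier) → (∀ i → P (f i)) → P (⋁ adm f)) →
    (∀ {x y} → P x → P y → P (x + y)) →
    P 0# →
    ∀ {x} → Generated Q S x → P x
  Generated-⊆ P S⊆P ⋁-closed +-closed 0-closed = go
    where
    go : ∀ {x} → Generated Q _ x → P x
    go (gen Sx)       = S⊆P Sx
    go (join adm f g) = ⋁-closed adm f (λ i → go (g i))
    go (plus gx gy)   = +-closed (go gx) (go gy)
    go zero           = 0-closed

module _ {s ℓ} {A : AddQuantaleMult s ℓ} (M : Module A)
         {γ : Module.Carrier M → Module.Carrier M} (nucleus : IsNucleus (Module.Q M) γ)
         (x : Module.Carrier M) where
  private module A = AddQuantaleMult A
  open Module M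
  open IsNucleus nucleus
  open import Relation.Binary.Reasoning.PartialOrder (≤-poset Q)

  CommutesLaxly : A.Carrier → Set ℓ
  CommutesLaxly a = a ∗ γ x ≤ γ (a ∗ x)

  CommutesLaxly-⋁ : ∀ {I : Set ℓ} (adm : Admissible s I) (f : I → A.Carrier) →
    (∀ i → CommutesLaxly (f i)) → CommutesLaxly (A.⋁ adm f)
  CommutesLaxly-⋁ adm f f-lax = begin
    A.⋁ adm f ∗ γ x             ≡⟨ ⋁-∗ adm f (γ x) ⟩
    ⋁ adm (λ i → f i ∗ γ x)     ≤⟨ ⋁-least adm _ _ fᵢ∗γx≤γ[⋁f∗x] ⟩
    γ (A.⋁ adm f ∗ x)           ∎
    where
    fᵢ∗γx≤γ[⋁f∗x] : ∀ i → f i ∗ γ x ≤ γ (A.⋁ adm f ∗ x)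
    fᵢ∗γx≤γ[⋁f∗x] i = begin
      f i ∗ γ x                 ≤⟨ f-lax i ⟩
      γ (f i ∗ x)               ≤⟨ mono (⋁-upper adm (λ j → f j ∗ x) i) ⟩
      γ (⋁ adm (λ j → f j ∗ x)) ≡⟨ cong γ (⋁-∗ adm f x) ⟨
      γ (A.⋁ adm f ∗ x)         ∎

  CommutesLaxly-+ : ∀ {a b} → CommutesLaxly a → CommutesLaxly b → CommutesLaxly (a A.+ b)
  CommutesLaxly-+ {a} {b} a-lax b-lax = begin
    (a A.+ b) ∗ γ x             ≡⟨ +-∗ a b (γ x) ⟩
    a ∗ γ x + b ∗ γ x           ≤⟨ +-mono a-lax b-lax ⟩
    γ (a ∗ x) + γ (b ∗ x)       ≤⟨ +-lax (a ∗ x) (b ∗ x) ⟩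
    γ (a ∗ x + b ∗ x)           ≡⟨ cong γ (+-∗ a b x) ⟨
    γ ((a A.+ b) ∗ x)           ∎

  CommutesLaxly-0 : CommutesLaxly A.0#
  CommutesLaxly-0 = begin
    A.0# ∗ γ x                  ≡⟨ 0-∗ (γ x) ⟩
    0#                          ≤⟨ expansive 0# ⟩
    γ 0#                        ≡⟨ cong γ (0-∗ x) ⟨
    γ (A.0# ∗ x)                ∎

lemma5p8 : ∀ {s ℓ} (A : AddQuantaleMult s ℓ) → DistributivelyGenerated A →
    (M : Module A) (γ : Module.Carrier M → Module.Carrier M) →
    IsNucleus (Module.Q M) γ →
    (∀ (d : AddQuantaleMult.D A) x →
      Module._≤_ M (Module._∗_ M (AddQuantaleMult.ι A d) (γ x)) (γ (Module._∗_ M (AddQuantaleMult.ι A d) x))) →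
    ∀ (a : AddQuantaleMult.Carrier A) x →
      Module._≤_ M (Module._∗_ M a (γ x)) (γ (Module._∗_ M a x))
lemma5p8 A generated M γ nucleus ι-lax a x =
  Generated-⊆ quantale (CommutesLaxly M nucleus x)
    (λ { (d , refl) → ι-lax d x })
    (CommutesLaxly-⋁ M nucleus x)
    (CommutesLaxly-+ M nucleus x)
    (CommutesLaxly-0 M nucleus x)
    (generated a)
  where open AddQuantaleMult A
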